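{- Let $n\ge 0$ and let $X\subseteq\{0,1\}^n$ be nonempty. For any tiebreaking rule and any initial vertex $\tilde x\in X$, Algorithm P (described in the context) visits every element of $X$ exactly once, and the sequence of visited elements is a Hamilton path on the skeleton of the 0/1-polytope $\mathrm{conv}(X)$ starting at $\tilde x$.
   Context: For distinct $x,y\in\{0,1\}^n$ let $\lambda(x,y):=\max\{i\in[n]: x_i\neq y_i\}$ (the largest index where $x,y$ differ), and let $d(x,y):=|\{i\in[n]: x_i\neq y_i\}|$ be the Hamming distance. The skeleton of a polytope is the graph formed by its vertices and edges (1-dimensional faces); the vertex set of $\mathrm{conv}(X)$ for $X\subseteq\{0,1\}^n$ is $X$. A tiebreaking rule is any rule that, given a nonempty set $N\subseteq X$ (and possibly the current state of the algorithm), selects one element of $N$. Algorithm P (input: $X$, initial vertex $\tilde x\in X$, a tiebreaking rule): (P1) set $x:=\tilde x$. (P2) Visit $x$. (P3) If all elements of $X$ have been visited, terminate; otherwise let $\beta:=\min\{\lambda(x,y): y\in X\setminus\{x\},\ y\text{ not yet visited}\}$. (P4) Let $N$ be the set of all $y\in X\setminus\{x\}$ with $\lambda(x,y)=\beta$ that minimize $d(x,y)$ among such $y$. (P5) Choose $y\in N$ by the tiebreaking rule, set $x:=y$ and go to (P2). -}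

module Defs where

open import Data.Bool using (Bool; true; false; _≟_)
open import Data.Nat as ℕ using (ℕ; zero; suc; _⊓_)
open import Data.Integer as ℤ using (ℤ; _+_; _≤_)
open import Data.Vec using (Vec; []; _∷_)
open import Data.Vec.Properties using (≡-dec)
open import Data.List using (List; []; _∷_; _++_; [_]; filter; map; foldr)
open import Data.List.Membership.Propositional using (_∈_)
open import Data.List.Relation.Unary.AllPairs using (AllPairs)
open import Data.List.Relation.Unary.Linked using (Linked)
open import Data.Maybe using (Maybe; just; nothing)
open import Data.Product using (Σ; _×_; _,_)
open import Data.Sum using (_⊎_)
open import Relation.Binary.PropositionalEquality using (_≡_; _≢_)
open import Relation.Binary.Definitions using (DecidableEquality)
open import Relation.Nullary using (¬?; _×-dec_)
import Data.List.Membership.DecPropositional as DecMem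

-- points of {0,1}^n ; coordinate i (1-based) is the i-th entry of the vector
BV : ℕ → Set
BV n = Vec Bool n

_≟BV_ : ∀ {n} → DecidableEquality (BV n)
_≟BV_ = ≡-dec _≟_

-- λ(x,y): largest (1-based) index i with x_i ≠ y_i  (0 if x = y)
lam : ∀ {n} → BV n → BV n → ℕ
lam [] [] = 0
lam (b ∷ xs) (c ∷ ys) with lam xs ys
... | suc k = suc (suc k)
... | zero with b ≟ c
...   | Relation.Nullary.yes _ = 0
...   | Relation.Nullary.no _ = 1

ham : ∀ {n} → BV n → BV n → ℕ
ham [] [] = 0
ham (b ∷ xs) (c ∷ ys) with b ≟ c
... | Relation.Nullary.yes _ = ham xs ys
... | Relation.Nullary.no _ = suc (ham xs ys)

-- minimum of a list of naturals (only used on nonempty lists)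
minL : List ℕ → ℕ
minL [] = 0
minL (a ∷ as) = foldr _⊓_ a as

-- A tiebreaking rule: given the current state of the algorithm (the history of
-- visited elements, in visiting order, whose last entry is the current x) and
-- the candidate set N, it returns an element (required to lie in N when N is nonempty).
Rule : ℕ → Set
Rule n = List (BV n) → List (BV n) → BV n

ValidRule : ∀ {n} → Rule n → Set
ValidRule {n} r = ∀ (h N : List (BV n)) → N ≢ [] → r h N ∈ N

-- One iteration of steps (P3)-(P5): given X, the rule, the history h and the
-- current vertex x, return nothing (terminate) or just the next vertex.
nextP : ∀ {n} → List (BV n) → Rule n → List (BV n) → BV n → Maybe (BV n)
nextP {n} X r h x with filter (λ y → ¬? (y ≟BV x) ×-dec ¬? (y ∈? h)) X
  where open DecMem (_≟BV_ {n})
... | [] = nothing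
... | unv@(_ ∷ _) =
  let β    = minL (map (lam x) unv)
      cand = filter (λ y → ¬? (y ≟BV x) ×-dec (lam x y ℕ.≟ β)) X
      δ    = minL (map (ham x) cand)
      N    = filter (λ y → ham x y ℕ.≟ δ) cand
  in just (r h N)

stateP : ∀ {n} → List (BV n) → BV n → Rule n → ℕ → List (BV n) × BV n
stateP X x₀ r zero = [ x₀ ] , x₀
stateP X x₀ r (suc k) with stateP X x₀ r k
... | (h , x) with nextP X r h x
...   | nothing = h , x
...   | just y  = h ++ [ y ] , y

TerminatesAt : ∀ {n} → List (BV n) → BV n → Rule n → ℕ → Set
TerminatesAt X x₀ r k with stateP X x₀ r k
... | (h , x) = nextP X r h x ≡ nothing

visited : ∀ {n} → List (BV n) → BV n → Rule n → ℕ → List (BV n)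
visited X x₀ r k with stateP X x₀ r k
... | (h , _) = h

dot : ∀ {n} → Vec ℤ n → BV n → ℤ
dot [] [] = ℤ.0ℤ
dot (c ∷ cs) (true ∷ xs) = c + dot cs xs
dot (c ∷ cs) (false ∷ xs) = dot cs xs

-- {x,y} is an edge (1-dimensional face) of conv(X): x ≠ y, both in X, and some
-- valid inequality c·z ≤ c·x (z ∈ X) is tight on X exactly at x and y.
Edge : ∀ {n} → List (BV n) → BV n → BV n → Set
Edge {n} X x y =
  x ≢ y × x ∈ X × y ∈ X ×
  Σ (Vec ℤ n) (λ c →
     dot c y ≡ dot c x ×
     (∀ z → z ∈ X → dot c z ≤ dot c x) ×
     (∀ z → z ∈ X → dot c z ≡ dot c x → z ≡ x ⊎ z ≡ y))

HamiltonPath : ∀ {n} → List (BV n) → BV n → List (BV n) → Set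
HamiltonPath {n} X s p =
  Σ (List (BV n)) (λ t → p ≡ s ∷ t) ×
  AllPairs _≢_ p ×
  (∀ z → z ∈ X → z ∈ p) ×
  (∀ z → z ∈ p → z ∈ X) ×
  Linked (Edge X) p

{-# OPTIONS --safe #-}
-- Write λ for lam. The vertices visited before the current vertex x always form a union of
-- classes {z : λ(x,z) = j}: λ is an ultrametric, and over {0,1} two points that differ from y
-- in coordinate λ(y,x) agree there. Hence the whole class λ(x,·) = β of step (P3) is unvisited,
-- the algorithm never revisits a vertex, and it stops once X is exhausted.
--
-- Each step x → y is an edge of conv(X) because y is Hamming-nearest to x in its class. With
-- D = d(x,y), take the linear functional that rewards agreeing with x by weight D on the
-- coordinates where x and y agree, by weight 1 on the other coordinates where they differ, and
-- by weight 1 − D at the coordinate λ(x,y). A point z that disagrees with x in s, l and p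
-- coordinates of these three kinds scores D·s + l − (D − 1)·p less than x, and p ≤ 1. This is
-- positive if s > 0, and equals l, vanishing only at z = x, if p = 0. If s = 0 and p = 1, then z
-- lies in the class of y, so l ≥ D − 1 by nearness, with equality only at z = y.
module Submission where

open import Defs
open import Data.Bool using (Bool; true; false)
open import Data.Empty using (⊥-elim)
open import Data.Integer as ℤ using (ℤ; +_; -_; 0ℤ; 1ℤ)
import Data.Integer.Properties as ℤ
import Data.Integer.Tactic.RingSolver as ℤ-Ring
open import Algebra.Properties.AbelianGroup ℤ.+-0-abelianGroup using (∙-cancelˡ; ∙-cancelʳ)
open import Data.List using (List; []; _∷_; _∷ʳ_; filter; map; length; last)
open import Data.List.Properties using (foldr-preservesᵒ; length-removeAt′; length-++)
open import Data.List.Membership.Propositional using (_∈_; _∉_; _─_)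
open import Data.List.Membership.Propositional.Properties
  using (foldr-selective; ∈-filter⁺; ∈-filter⁻; ∈-map⁺; ∈-map⁻; ∈-++⁺ˡ; ∈-++⁺ʳ; ∈-++⁻)
import Data.List.Membership.DecPropositional as DecMembership
open import Data.List.Relation.Unary.Any as Any using (Any; here; there; index)
open import Data.List.Relation.Unary.All as All using (All; []; _∷_)
open import Data.List.Relation.Unary.AllPairs using (AllPairs; []; _∷_)
import Data.List.Relation.Unary.AllPairs.Properties as AllPairs
open import Data.List.Relation.Unary.Linked using (Linked; [-])
import Data.List.Relation.Unary.Linked.Properties as Linked
open import Data.Maybe using (just; nothing)
open import Data.Maybe.Relation.Binary.Connected using (Connected; just)
open import Data.Nat as ℕ using (ℕ; zero; suc; _+_; _*_; _≤_; _<_; z≤n; s≤s; s≤s⁻¹; _⊓_)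
open import Data.Nat.Properties
  using ( module ≤-Reasoning; ≤-refl; ≤-trans; <-≤-trans; <-cmp; <⇒≱; n<1⇒n≡0; n≤1+n; m≤m+n
        ; +-comm; +-assoc; +-suc; +-identityʳ; +-cancelʳ-≡; suc-injective; m≢1+m+n; 0≢1+n
        ; ⊓-sel; m≤n⇒m⊓o≤n; m≤n⇒o⊓m≤n)
open import Data.Product using (Σ; ∃; _×_; _,_; proj₁; proj₂)
open import Data.Sum using (_⊎_; inj₁; inj₂; [_,_])
open import Data.Vec as Vec using (Vec; []; _∷_)
open import Function using (_∘_)
open import Relation.Binary.Definitions using (tri<; tri≈; tri>)
open import Relation.Binary.PropositionalEquality hiding ([_])
open import Relation.Nullary using (yes; no; does; ¬?; _×-dec_)
open import Relation.Unary using (Decidable)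

private variable
  n : ℕ

-- λ is an ultrametric

-- λ of two extended vectors from λ of their tails, which hold the higher coordinates.
lamCons : Bool → Bool → ℕ → ℕ
lamCons _     _     (suc k) = suc (suc k)
lamCons false false zero    = 0
lamCons true  true  zero    = 0
lamCons false true  zero    = 1
lamCons true  false zero    = 1

lam-∷ : ∀ b c (xs ys : BV n) → lam (b ∷ xs) (c ∷ ys) ≡ lamCons b c (lam xs ys)
lam-∷ b c xs ys with lam xs ys
... | suc k = refl
lam-∷ false false xs ys | zero = refl
lam-∷ true  true  xs ys | zero = refl
lam-∷ false true  xs ys | zero = refl
lam-∷ true  false xs ys | zero = refl

lamCons-self : ∀ b → lamCons b b 0 ≡ 0
lamCons-self false = refl
lamCons-self true  = refl

lamCons≡0 : ∀ b c t → lamCons b c t ≡ 0 → b ≡ c × t ≡ 0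
lamCons≡0 false false zero _ = refl , refl
lamCons≡0 true  true  zero _ = refl , refl

lamCons-sym : ∀ b c t → lamCons b c t ≡ lamCons c b t
lamCons-sym _     _     (suc k) = refl
lamCons-sym false false zero    = refl
lamCons-sym true  true  zero    = refl
lamCons-sym false true  zero    = refl
lamCons-sym true  false zero    = refl

lamCons≤1+ : ∀ b c t → lamCons b c t ≤ suc t
lamCons≤1+ _     _     (suc k) = ≤-refl
lamCons≤1+ false false zero    = z≤n
lamCons≤1+ true  true  zero    = z≤n
lamCons≤1+ false true  zero    = ≤-refl
lamCons≤1+ true  false zero    = ≤-refl

lam-self : (x : BV n) → lam x x ≡ 0
lam-self []       = refl
lam-self (b ∷ xs) rewrite lam-∷ b b xs xs | lam-self xs = lamCons-self b

lam≡0⇒≡ : {x y : BV n} → lam x y ≡ 0 → x ≡ y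
lam≡0⇒≡ {x = []}     {[]}     _  = refl
lam≡0⇒≡ {x = b ∷ xs} {c ∷ ys} eq with lamCons≡0 b c (lam xs ys) (trans (sym (lam-∷ b c xs ys)) eq)
... | refl , tails = cong (b ∷_) (lam≡0⇒≡ tails)

lam-sym : (x y : BV n) → lam x y ≡ lam y x
lam-sym []       []       = refl
lam-sym (b ∷ xs) (c ∷ ys) rewrite lam-∷ b c xs ys | lam-∷ c b ys xs | lam-sym xs ys =
  lamCons-sym b c (lam ys xs)

lamCons-< : ∀ a b c t u → lamCons a b t < lamCons a c u → (a ≡ b × t ≡ 0) ⊎ t < u
lamCons-< a b c zero    (suc k) _          = inj₂ (s≤s z≤n)
lamCons-< a b c (suc j) (suc k) (s≤s j<k) = inj₂ j<k
lamCons-< a b c t       zero    lt         =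
  inj₁ (lamCons≡0 a b t (n<1⇒n≡0 (<-≤-trans lt (lamCons≤1+ a c 0))))

-- The binary alphabet enters here: x and z both differ from y in the same coordinate.
lamCons-binary : ∀ y x z t → 0 < lamCons y x 0 → lamCons y z t ≡ lamCons y x 0 → x ≡ z × t ≡ 0
lamCons-binary false true  true  zero    _  _  = refl , refl
lamCons-binary true  false false zero    _  _  = refl , refl
lamCons-binary false false _     _       () _
lamCons-binary true  true  _     _       () _
lamCons-binary false true  false zero    _  ()
lamCons-binary true  false true  zero    _  ()
lamCons-binary false true  _     (suc _) _  ()
lamCons-binary true  false _     (suc _) _  ()

lamCons-suc-injective : ∀ b c t {k} → lamCons b c t ≡ suc (suc k) → t ≡ suc k
lamCons-suc-injective _     _     (suc _) refl = refl
lamCons-suc-injective false false zero    ()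
lamCons-suc-injective true  true  zero    ()
lamCons-suc-injective false true  zero    ()
lamCons-suc-injective true  false zero    ()

lamCons-head-irrelevant : ∀ a b c d {t} → 0 < t → lamCons a b t ≡ lamCons c d t
lamCons-head-irrelevant a b c d {suc _} _ = refl

lam-isosceles : (x y z : BV n) → lam x y < lam x z → lam y z ≡ lam x z
lam-isosceles [] [] [] ()
lam-isosceles (a ∷ xs) (b ∷ ys) (c ∷ zs) lt
  rewrite lam-∷ a b xs ys | lam-∷ a c xs zs | lam-∷ b c ys zs
  with lamCons-< a b c (lam xs ys) (lam xs zs) lt
... | inj₁ (refl , xs~ys) rewrite lam≡0⇒≡ {x = xs} {ys} xs~ys = refl
... | inj₂ t<u rewrite lam-isosceles xs ys zs t<u = lamCons-head-irrelevant b c a c (≤-trans (s≤s z≤n) t<u)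

lam-binary : (y x z : BV n) → 0 < lam y x → lam y z ≡ lam y x → lam x z < lam y x
lam-binary [] [] [] ()
lam-binary (b ∷ ys) (a ∷ xs) (c ∷ zs) pos eq
  rewrite lam-∷ b a ys xs | lam-∷ b c ys zs | lam-∷ a c xs zs
  with lam ys xs in ys~xs
... | suc k = ≤-trans (s≤s (lamCons≤1+ a c (lam xs zs))) (s≤s (subst (lam xs zs <_) ys~xs tails))
  where
  tails : lam xs zs < lam ys xs
  tails = lam-binary ys xs zs (subst (0 <_) (sym ys~xs) (s≤s z≤n))
            (trans (lamCons-suc-injective b c (lam ys zs) eq) (sym ys~xs))
... | zero with lamCons-binary b a c (lam ys zs) pos eq
...   | refl , ys~zs
  rewrite sym (lam≡0⇒≡ {x = ys} ys~xs) | ys~zs | lamCons-self c = pos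

≢⇒lam>0 : {x y : BV n} → x ≢ y → 0 < lam x y
≢⇒lam>0 {x = x} {y} x≢y with lam x y in eq
... | zero  = ⊥-elim (x≢y (lam≡0⇒≡ eq))
... | suc _ = s≤s z≤n

-- Every step is an edge of conv(X)

ham≡0⇒≡ : {x y : BV n} → ham x y ≡ 0 → x ≡ y
ham≡0⇒≡ {x = []}         {[]}         _  = refl
ham≡0⇒≡ {x = false ∷ xs} {false ∷ ys} eq = cong (false ∷_) (ham≡0⇒≡ eq)
ham≡0⇒≡ {x = true  ∷ xs} {true  ∷ ys} eq = cong (true ∷_) (ham≡0⇒≡ eq)

-- The role of coordinate i for a pair x, y: shared if x_i = y_i, pivot if i = λ(x,y), and
-- lower for the other coordinates where x and y differ.
data Role : Set where
  shared pivot lower : Role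

role : Bool → Bool → Bool → Role
role false false _     = shared
role true  true  _     = shared
role _     _     true  = pivot
role _     _     false = lower

roles : BV n → BV n → Vec Role n
roles []       []       = []
roles (a ∷ xs) (b ∷ ys) = role a b (does (xs ≟BV ys)) ∷ roles xs ys

tick : Role → Role → ℕ
tick shared shared = 1
tick pivot  pivot  = 1
tick lower  lower  = 1
tick _      _      = 0

flips : Role → Vec Role n → BV n → BV n → ℕ
flips ρ []       []           []           = 0
flips ρ (σ ∷ σs) (false ∷ xs) (false ∷ zs) = flips ρ σs xs zs
flips ρ (σ ∷ σs) (true  ∷ xs) (true  ∷ zs) = flips ρ σs xs zs
flips ρ (σ ∷ σs) (_     ∷ xs) (_     ∷ zs) = tick ρ σ + flips ρ σs xs zs

flipSum : Vec ℤ n → BV n → BV n → ℤ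
flipSum []       []           []           = 0ℤ
flipSum (w ∷ ws) (false ∷ xs) (false ∷ zs) = flipSum ws xs zs
flipSum (w ∷ ws) (true  ∷ xs) (true  ∷ zs) = flipSum ws xs zs
flipSum (w ∷ ws) (_     ∷ xs) (_     ∷ zs) = w ℤ.+ flipSum ws xs zs

toward : BV n → Vec ℤ n → Vec ℤ n
toward []           []       = []
toward (true  ∷ xs) (w ∷ ws) = w ∷ toward xs ws
toward (false ∷ xs) (w ∷ ws) = - w ∷ toward xs ws

dot-toward : (x z : BV n) (ws : Vec ℤ n) →
             dot (toward x ws) z ℤ.+ flipSum ws x z ≡ dot (toward x ws) x
dot-toward []           []           []       = refl
dot-toward (true  ∷ xs) (true  ∷ zs) (w ∷ ws) =
  trans (ℤ.+-assoc w _ _) (cong (ℤ._+_ w) (dot-toward xs zs ws))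
dot-toward (false ∷ xs) (false ∷ zs) (w ∷ ws) = dot-toward xs zs ws
dot-toward (true  ∷ xs) (false ∷ zs) (w ∷ ws) =
  trans (swap w (dot (toward xs ws) zs) (flipSum ws xs zs)) (cong (ℤ._+_ w) (dot-toward xs zs ws))
  where
  swap : ∀ a b c → b ℤ.+ (a ℤ.+ c) ≡ a ℤ.+ (b ℤ.+ c)
  swap = ℤ-Ring.solve-∀
dot-toward (false ∷ xs) (true  ∷ zs) (w ∷ ws) =
  trans (cancel w (dot (toward xs ws) zs) (flipSum ws xs zs)) (dot-toward xs zs ws)
  where
  cancel : ∀ a b c → (- a ℤ.+ b) ℤ.+ (a ℤ.+ c) ≡ b ℤ.+ c
  cancel = ℤ-Ring.solve-∀

weighted : (Role → ℤ) → (Role → ℕ) → ℤ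
weighted w f = w shared ℤ.* + f shared ℤ.+ w pivot ℤ.* + f pivot ℤ.+ w lower ℤ.* + f lower

weighted-tick : ∀ w σ f → w σ ℤ.+ weighted w f ≡ weighted w (λ ρ → tick ρ σ + f ρ)
weighted-tick w shared f = shift (w shared) (w pivot) (w lower) (+ f shared) (+ f pivot) (+ f lower)
  where
  shift : ∀ a b c s p l → a ℤ.+ (a ℤ.* s ℤ.+ b ℤ.* p ℤ.+ c ℤ.* l) ≡ a ℤ.* (1ℤ ℤ.+ s) ℤ.+ b ℤ.* p ℤ.+ c ℤ.* l
  shift = ℤ-Ring.solve-∀
weighted-tick w pivot f = shift (w shared) (w pivot) (w lower) (+ f shared) (+ f pivot) (+ f lower)
  where
  shift : ∀ a b c s p l → b ℤ.+ (a ℤ.* s ℤ.+ b ℤ.* p ℤ.+ c ℤ.* l) ≡ a ℤ.* s ℤ.+ b ℤ.* (1ℤ ℤ.+ p) ℤ.+ c ℤ.* l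
  shift = ℤ-Ring.solve-∀
weighted-tick w lower f = shift (w shared) (w pivot) (w lower) (+ f shared) (+ f pivot) (+ f lower)
  where
  shift : ∀ a b c s p l → c ℤ.+ (a ℤ.* s ℤ.+ b ℤ.* p ℤ.+ c ℤ.* l) ≡ a ℤ.* s ℤ.+ b ℤ.* p ℤ.+ c ℤ.* (1ℤ ℤ.+ l)
  shift = ℤ-Ring.solve-∀

flipSum-map : (w : Role → ℤ) (σs : Vec Role n) (x z : BV n) →
              flipSum (Vec.map w σs) x z ≡ weighted w (λ ρ → flips ρ σs x z)
flipSum-map w []       []           []           = vanish (w shared) (w pivot) (w lower)
  where
  vanish : ∀ a b c → 0ℤ ≡ a ℤ.* 0ℤ ℤ.+ b ℤ.* 0ℤ ℤ.+ c ℤ.* 0ℤ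
  vanish = ℤ-Ring.solve-∀
flipSum-map w (σ ∷ σs) (false ∷ xs) (false ∷ zs) = flipSum-map w σs xs zs
flipSum-map w (σ ∷ σs) (true  ∷ xs) (true  ∷ zs) = flipSum-map w σs xs zs
flipSum-map w (σ ∷ σs) (false ∷ xs) (true  ∷ zs) =
  trans (cong (ℤ._+_ (w σ)) (flipSum-map w σs xs zs)) (weighted-tick w σ (λ ρ → flips ρ σs xs zs))
flipSum-map w (σ ∷ σs) (true  ∷ xs) (false ∷ zs) =
  trans (cong (ℤ._+_ (w σ)) (flipSum-map w σs xs zs)) (weighted-tick w σ (λ ρ → flips ρ σs xs zs))

total : (Role → ℕ) → ℕ
total f = f shared + f pivot + f lower

total-tick : ∀ σ f → suc (total f) ≡ total (λ ρ → tick ρ σ + f ρ)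
total-tick shared f = refl
total-tick pivot  f = cong (_+ f lower) (sym (+-suc (f shared) (f pivot)))
total-tick lower  f = sym (+-suc (f shared + f pivot) (f lower))

ham-flips : (σs : Vec Role n) (x z : BV n) → ham x z ≡ total (λ ρ → flips ρ σs x z)
ham-flips []       []           []           = refl
ham-flips (σ ∷ σs) (false ∷ xs) (false ∷ zs) = ham-flips σs xs zs
ham-flips (σ ∷ σs) (true  ∷ xs) (true  ∷ zs) = ham-flips σs xs zs
ham-flips (σ ∷ σs) (false ∷ xs) (true  ∷ zs) =
  trans (cong suc (ham-flips σs xs zs)) (total-tick σ (λ ρ → flips ρ σs xs zs))
ham-flips (σ ∷ σs) (true  ∷ xs) (false ∷ zs) =
  trans (cong suc (ham-flips σs xs zs)) (total-tick σ (λ ρ → flips ρ σs xs zs))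

flips-pivot-self : (x z : BV n) → flips pivot (roles x x) x z ≡ 0
flips-pivot-self []           []           = refl
flips-pivot-self (false ∷ xs) (false ∷ zs) = flips-pivot-self xs zs
flips-pivot-self (false ∷ xs) (true  ∷ zs) = flips-pivot-self xs zs
flips-pivot-self (true  ∷ xs) (false ∷ zs) = flips-pivot-self xs zs
flips-pivot-self (true  ∷ xs) (true  ∷ zs) = flips-pivot-self xs zs

flips-shared-self : (x z : BV n) → flips shared (roles x x) x z ≡ ham x z
flips-shared-self []           []           = refl
flips-shared-self (false ∷ xs) (false ∷ zs) = flips-shared-self xs zs
flips-shared-self (false ∷ xs) (true  ∷ zs) = cong suc (flips-shared-self xs zs)
flips-shared-self (true  ∷ xs) (false ∷ zs) = cong suc (flips-shared-self xs zs)
flips-shared-self (true  ∷ xs) (true  ∷ zs) = flips-shared-self xs zs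

ham-other-flips : (x y z : BV n) →
  ham y z + (flips pivot (roles x y) x z + flips lower (roles x y) x z) ≡ flips shared (roles x y) x z + ham x y
ham-other-flips []           []           []           = refl
ham-other-flips (false ∷ xs) (false ∷ ys) (false ∷ zs) = ham-other-flips xs ys zs
ham-other-flips (true  ∷ xs) (true  ∷ ys) (true  ∷ zs) = ham-other-flips xs ys zs
ham-other-flips (false ∷ xs) (false ∷ ys) (true  ∷ zs) = cong suc (ham-other-flips xs ys zs)
ham-other-flips (true  ∷ xs) (true  ∷ ys) (false ∷ zs) = cong suc (ham-other-flips xs ys zs)
ham-other-flips (false ∷ xs) (true  ∷ ys) (false ∷ zs) = trans (cong suc (ham-other-flips xs ys zs)) (sym (+-suc _ _))
ham-other-flips (true  ∷ xs) (false ∷ ys) (true  ∷ zs) = trans (cong suc (ham-other-flips xs ys zs)) (sym (+-suc _ _))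
ham-other-flips (false ∷ xs) (true  ∷ ys) (true  ∷ zs) with xs ≟BV ys
... | yes _ = trans (+-suc (ham ys zs) _) (trans (cong suc (ham-other-flips xs ys zs)) (sym (+-suc _ _)))
... | no  _ = trans (cong (_+_ (ham ys zs)) (+-suc _ _))
                    (trans (+-suc (ham ys zs) _) (trans (cong suc (ham-other-flips xs ys zs)) (sym (+-suc _ _))))
ham-other-flips (true  ∷ xs) (false ∷ ys) (false ∷ zs) with xs ≟BV ys
... | yes _ = trans (+-suc (ham ys zs) _) (trans (cong suc (ham-other-flips xs ys zs)) (sym (+-suc _ _)))
... | no  _ = trans (cong (_+_ (ham ys zs)) (+-suc _ _))
                    (trans (+-suc (ham ys zs) _) (trans (cong suc (ham-other-flips xs ys zs)) (sym (+-suc _ _))))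

flips-pivot≤1 : (x y z : BV n) → flips pivot (roles x y) x z ≤ 1
flips-pivot≤1 []           []           []           = z≤n
flips-pivot≤1 (false ∷ xs) (_     ∷ ys) (false ∷ zs) = flips-pivot≤1 xs ys zs
flips-pivot≤1 (true  ∷ xs) (_     ∷ ys) (true  ∷ zs) = flips-pivot≤1 xs ys zs
flips-pivot≤1 (false ∷ xs) (false ∷ ys) (true  ∷ zs) = flips-pivot≤1 xs ys zs
flips-pivot≤1 (true  ∷ xs) (true  ∷ ys) (false ∷ zs) = flips-pivot≤1 xs ys zs
flips-pivot≤1 (false ∷ xs) (true  ∷ ys) (true  ∷ zs) with xs ≟BV ys
... | yes refl rewrite flips-pivot-self xs zs = ≤-refl
... | no  _    = flips-pivot≤1 xs ys zs
flips-pivot≤1 (true  ∷ xs) (false ∷ ys) (false ∷ zs) with xs ≟BV ys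
... | yes refl rewrite flips-pivot-self xs zs = ≤-refl
... | no  _    = flips-pivot≤1 xs ys zs

flips-pivot-other : {x y : BV n} → x ≢ y → flips pivot (roles x y) x y ≡ 1
flips-pivot-other {x = []}         {[]}         x≢y = ⊥-elim (x≢y refl)
flips-pivot-other {x = false ∷ xs} {false ∷ ys} x≢y = flips-pivot-other (x≢y ∘ cong (false ∷_))
flips-pivot-other {x = true  ∷ xs} {true  ∷ ys} x≢y = flips-pivot-other (x≢y ∘ cong (true ∷_))
flips-pivot-other {x = false ∷ xs} {true  ∷ ys} _ with xs ≟BV ys
... | yes refl = cong suc (flips-pivot-self xs xs)
... | no  xs≢ys = flips-pivot-other xs≢ys
flips-pivot-other {x = true  ∷ xs} {false ∷ ys} _ with xs ≟BV ys
... | yes refl = cong suc (flips-pivot-self xs xs)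
... | no  xs≢ys = flips-pivot-other xs≢ys

flips-pivot≡1⇒≢ : (x y z : BV n) → flips pivot (roles x y) x z ≡ 1 → x ≢ y
flips-pivot≡1⇒≢ x .x z p≡1 refl with () ← trans (sym p≡1) (flips-pivot-self x z)

flips⇒same-lam : (x y z : BV n) → flips shared (roles x y) x z ≡ 0 → flips pivot (roles x y) x z ≡ 1 →
             lam x z ≡ lam x y
flips⇒same-lam []           []           []           _  ()
flips⇒same-lam (false ∷ xs) (false ∷ ys) (true  ∷ zs) () _
flips⇒same-lam (true  ∷ xs) (true  ∷ ys) (false ∷ zs) () _
flips⇒same-lam (false ∷ xs) (false ∷ ys) (false ∷ zs) s≡0 p≡1
  rewrite lam-∷ false false xs zs | lam-∷ false false xs ys | flips⇒same-lam xs ys zs s≡0 p≡1 = refl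
flips⇒same-lam (true  ∷ xs) (true  ∷ ys) (true  ∷ zs) s≡0 p≡1
  rewrite lam-∷ true true xs zs | lam-∷ true true xs ys | flips⇒same-lam xs ys zs s≡0 p≡1 = refl
flips⇒same-lam (false ∷ xs) (true  ∷ ys) (false ∷ zs) s≡0 p≡1
  rewrite lam-∷ false false xs zs | lam-∷ false true xs ys | flips⇒same-lam xs ys zs s≡0 p≡1 =
  lamCons-head-irrelevant false false false true (≢⇒lam>0 (flips-pivot≡1⇒≢ xs ys zs p≡1))
flips⇒same-lam (true  ∷ xs) (false ∷ ys) (true  ∷ zs) s≡0 p≡1
  rewrite lam-∷ true true xs zs | lam-∷ true false xs ys | flips⇒same-lam xs ys zs s≡0 p≡1 =
  lamCons-head-irrelevant true true true false (≢⇒lam>0 (flips-pivot≡1⇒≢ xs ys zs p≡1))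
flips⇒same-lam (false ∷ xs) (true  ∷ ys) (true  ∷ zs) s≡0 p≡1 with xs ≟BV ys
... | yes refl with refl ← ham≡0⇒≡ {x = xs} {zs} (trans (sym (flips-shared-self xs zs)) s≡0) = refl
... | no  _    rewrite lam-∷ false true xs zs | lam-∷ false true xs ys | flips⇒same-lam xs ys zs s≡0 p≡1 = refl
flips⇒same-lam (true  ∷ xs) (false ∷ ys) (false ∷ zs) s≡0 p≡1 with xs ≟BV ys
... | yes refl with refl ← ham≡0⇒≡ {x = xs} {zs} (trans (sym (flips-shared-self xs zs)) s≡0) = refl
... | no  _    rewrite lam-∷ true false xs zs | lam-∷ true false xs ys | flips⇒same-lam xs ys zs s≡0 p≡1 = refl

flips-self : (ρ : Role) (σs : Vec Role n) (x : BV n) → flips ρ σs x x ≡ 0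
flips-self ρ []       []           = refl
flips-self ρ (σ ∷ σs) (false ∷ xs) = flips-self ρ σs xs
flips-self ρ (σ ∷ σs) (true  ∷ xs) = flips-self ρ σs xs

flips-shared-other : (x y : BV n) → flips shared (roles x y) x y ≡ 0
flips-shared-other []           []           = refl
flips-shared-other (false ∷ xs) (false ∷ ys) = flips-shared-other xs ys
flips-shared-other (true  ∷ xs) (true  ∷ ys) = flips-shared-other xs ys
flips-shared-other (false ∷ xs) (true  ∷ ys) with xs ≟BV ys
... | yes _ = flips-shared-other xs ys
... | no  _ = flips-shared-other xs ys
flips-shared-other (true  ∷ xs) (false ∷ ys) with xs ≟BV ys
... | yes _ = flips-shared-other xs ys
... | no  _ = flips-shared-other xs ys

balanced⇒≤ : ∀ {a b : ℤ} {u v : ℕ} → a ℤ.+ + u ≡ b ℤ.+ + v → v ≤ u → a ℤ.≤ b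
balanced⇒≤ {a} {b} {u} {v} eq v≤u = begin
  a                       ≡⟨ shift a (+ u) ⟩
  a ℤ.+ + u ℤ.- + u       ≡⟨ cong (ℤ._- + u) eq ⟩
  b ℤ.+ + v ℤ.- + u       ≤⟨ ℤ.+-monoˡ-≤ (- + u) (ℤ.+-monoʳ-≤ b (ℤ.+≤+ v≤u)) ⟩
  b ℤ.+ + u ℤ.- + u       ≡⟨ sym (shift b (+ u)) ⟩
  b                       ∎
  where
  open ℤ.≤-Reasoning
  shift : ∀ a u → a ≡ a ℤ.+ u ℤ.- u
  shift = ℤ-Ring.solve-∀

balanced⇒≡ : ∀ {a b : ℤ} {u v : ℕ} → a ℤ.+ + u ≡ b ℤ.+ + v → a ≡ b → u ≡ v
balanced⇒≡ {a} {u = u} {v} eq refl = ℤ.+-injective (∙-cancelˡ a (+ u) (+ v) eq)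

gap-nonneg : ∀ K s p l → p ≤ 1 → (s ≡ 0 → p ≡ 1 → suc K ≤ p + l) → p * K ≤ s * suc K + l
gap-nonneg K s       zero    l _ _ = z≤n
gap-nonneg K zero    (suc zero) l _ minimal rewrite +-identityʳ K = s≤s⁻¹ (minimal refl refl)
gap-nonneg K (suc s) (suc zero) l _ _ rewrite +-identityʳ K =
  ≤-trans (n≤1+n K) (≤-trans (m≤m+n (suc K) (s * suc K)) (m≤m+n _ l))
gap-nonneg K s (suc (suc p)) l (s≤s ()) _

gap-zero : ∀ K s p l → p ≤ 1 → p * K ≡ s * suc K + l → s + p + l ≡ 0 ⊎ (s ≡ 0 × p + l ≡ suc K)
gap-zero K zero    zero       l _ eq = inj₁ (sym eq)
gap-zero K zero    (suc zero) l _ eq = inj₂ (refl , cong suc (trans (sym eq) (+-identityʳ K)))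
gap-zero K (suc s) (suc zero) l _ eq =
  ⊥-elim (m≢1+m+n K (trans (sym (+-identityʳ K)) (trans eq (cong suc (+-assoc K (s * suc K) l)))))
gap-zero K s (suc (suc p)) l (s≤s ()) _

-- The supporting functional for an edge {x, y} with d(x,y) = suc K.
weight : ℕ → Role → ℤ
weight K shared = + suc K
weight K pivot  = - + K
weight K lower  = 1ℤ

normal : ℕ → BV n → BV n → Vec ℤ n
normal K x y = toward x (Vec.map (weight K) (roles x y))

dot-normal : ∀ K (x y z : BV n) →
  let f ρ = flips ρ (roles x y) x z in
  dot (normal K x y) z ℤ.+ + (f shared * suc K + f lower) ≡ dot (normal K x y) x ℤ.+ + (f pivot * K)
dot-normal K x y z = begin
  dot c z ℤ.+ + (s * suc K + l)                ≡⟨ cong (ℤ._+_ (dot c z)) counts ⟩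
  dot c z ℤ.+ (flipSum ws x z ℤ.+ + (p * K))   ≡⟨ sym (ℤ.+-assoc (dot c z) _ _) ⟩
  dot c z ℤ.+ flipSum ws x z ℤ.+ + (p * K)     ≡⟨ cong (ℤ._+ + (p * K)) (dot-toward x z ws) ⟩
  dot c x ℤ.+ + (p * K)                        ∎
  where
  open ≡-Reasoning
  ws = Vec.map (weight K) (roles x y)
  c = normal K x y
  s = flips shared (roles x y) x z
  p = flips pivot (roles x y) x z
  l = flips lower (roles x y) x z
  counts : + (s * suc K + l) ≡ flipSum ws x z ℤ.+ + (p * K)
  counts = begin
    + (s * suc K + l)                        ≡⟨ ℤ.pos-+ (s * suc K) l ⟩
    + (s * suc K) ℤ.+ + l                    ≡⟨ cong (ℤ._+ + l) (ℤ.pos-* s (suc K)) ⟩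
    + s ℤ.* + suc K ℤ.+ + l                  ≡⟨ regroup (+ suc K) (+ K) (+ s) (+ p) (+ l) ⟩
    weighted (weight K) (λ ρ → flips ρ (roles x y) x z) ℤ.+ + p ℤ.* + K
      ≡⟨ cong₂ ℤ._+_ (sym (flipSum-map (weight K) (roles x y) x z)) (sym (ℤ.pos-* p K)) ⟩
    flipSum ws x z ℤ.+ + (p * K)             ∎
    where
    regroup : ∀ D K s p l → s ℤ.* D ℤ.+ l ≡ D ℤ.* s ℤ.+ - K ℤ.* p ℤ.+ 1ℤ ℤ.* l ℤ.+ p ℤ.* K
    regroup = ℤ-Ring.solve-∀

nearest⇒Edge : {X : List (BV n)} {x y : BV n} → x ≢ y → x ∈ X → y ∈ X →
  (∀ {z} → z ∈ X → z ≢ x → lam x z ≡ lam x y → ham x y ≤ ham x z) → Edge X x y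
nearest⇒Edge {X = X} {x} {y} x≢y x∈X y∈X nearest with ham x y in D≡
... | zero  = ⊥-elim (x≢y (ham≡0⇒≡ D≡))
... | suc K = x≢y , x∈X , y∈X , normal K x y , on-face , below , face-only
  where
  f : BV _ → Role → ℕ
  f z ρ = flips ρ (roles x y) x z

  minimal : ∀ {z} → z ∈ X → f z shared ≡ 0 → f z pivot ≡ 1 → suc K ≤ f z pivot + f z lower
  minimal {z} z∈X s≡0 p≡1 =
    subst (suc K ≤_) (trans (ham-flips (roles x y) x z) (cong (λ s → s + f z pivot + f z lower) s≡0))
          (nearest z∈X z≢x (flips⇒same-lam x y z s≡0 p≡1))
    where
    z≢x : z ≢ x
    z≢x refl = 0≢1+n (trans (sym (flips-self pivot (roles x y) x)) p≡1)

  below : ∀ z → z ∈ X → dot (normal K x y) z ℤ.≤ dot (normal K x y) x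
  below z z∈X =
    balanced⇒≤ (dot-normal K x y z) (gap-nonneg K _ _ _ (flips-pivot≤1 x y z) (minimal z∈X))

  face-only : ∀ z → z ∈ X → dot (normal K x y) z ≡ dot (normal K x y) x → z ≡ x ⊎ z ≡ y
  face-only z z∈X eq
    with gap-zero K _ _ _ (flips-pivot≤1 x y z) (sym (balanced⇒≡ (dot-normal K x y z) eq))
  ... | inj₁ none = inj₁ (sym (ham≡0⇒≡ (trans (ham-flips (roles x y) x z) none)))
  ... | inj₂ (s≡0 , p+l≡D) = inj₂ (sym (ham≡0⇒≡ (+-cancelʳ-≡ (suc K) (ham y z) 0 (begin
    ham y z + suc K                    ≡⟨ cong (_+_ (ham y z)) (sym p+l≡D) ⟩
    ham y z + (f z pivot + f z lower)  ≡⟨ ham-other-flips x y z ⟩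
    f z shared + ham x y               ≡⟨ cong₂ _+_ s≡0 D≡ ⟩
    suc K                              ∎))))
    where open ≡-Reasoning

  on-face : dot (normal K x y) y ≡ dot (normal K x y) x
  on-face = ∙-cancelʳ (+ (f y pivot * K)) _ _
    (trans (cong (λ u → dot (normal K x y) y ℤ.+ + u) (sym u≡v)) (dot-normal K x y y))
    where
    l≡K : f y lower ≡ K
    l≡K = suc-injective (begin
      suc (f y lower)
        ≡⟨ cong₂ (λ s p → s + p + f y lower) (sym (flips-shared-other x y)) (sym (flips-pivot-other x≢y)) ⟩
      f y shared + f y pivot + f y lower  ≡⟨ sym (ham-flips (roles x y) x y) ⟩
      ham x y                             ≡⟨ D≡ ⟩
      suc K                               ∎)
      where open ≡-Reasoning
    u≡v : f y shared * suc K + f y lower ≡ f y pivot * K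
    u≡v rewrite flips-shared-other x y | flips-pivot-other x≢y | +-identityʳ K = l≡K

-- Minima and the pigeonhole principle for lists

minL-≤ : ∀ {v l} → v ∈ l → minL l ≤ v
minL-≤ {v} {a ∷ as} v∈l = foldr-preservesᵒ pres a as (bound v∈l)
  where
  pres : ∀ m n → m ≤ v ⊎ n ≤ v → m ⊓ n ≤ v
  pres m n = [ m≤n⇒m⊓o≤n n , m≤n⇒o⊓m≤n m ]
  bound : v ∈ a ∷ as → a ≤ v ⊎ Any (_≤ v) as
  bound (here refl)  = inj₁ ≤-refl
  bound (there v∈as) = inj₂ (Any.map (λ { refl → ≤-refl }) v∈as)

minL-∈ : ∀ a as → minL (a ∷ as) ∈ a ∷ as
minL-∈ a as with foldr-selective ⊓-sel a as
... | inj₁ min≡a  = here min≡a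
... | inj₂ min∈as = there min∈as

module _ {A : Set} (f : A → ℕ) where

  minL-map-≤ : ∀ {v l} → v ∈ l → minL (map f l) ≤ f v
  minL-map-≤ v∈l = minL-≤ (∈-map⁺ f v∈l)

  minL-map-attained : ∀ {v l} → v ∈ l → ∃ λ u → u ∈ l × f u ≡ minL (map f l)
  minL-map-attained {l = a ∷ as} _ with ∈-map⁻ f (minL-∈ (f a) (map f as))
  ... | u , u∈l , min≡fu = u , u∈l , sym min≡fu

∈-─ : ∀ {A : Set} {v w : A} {ys : List A} (v∈ys : v ∈ ys) → w ∈ ys → w ≢ v → w ∈ ys ─ v∈ys
∈-─ (here refl) (here refl)  w≢v = ⊥-elim (w≢v refl)
∈-─ (here refl) (there w∈ys) _   = w∈ys
∈-─ (there _)   (here refl)  _   = here refl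
∈-─ (there v∈ys) (there w∈ys) w≢v = there (∈-─ v∈ys w∈ys w≢v)

last-∷ʳ : ∀ {A : Set} (xs : List A) (x : A) → last (xs ∷ʳ x) ≡ just x
last-∷ʳ []           x = refl
last-∷ʳ (_ ∷ [])     x = refl
last-∷ʳ (_ ∷ _ ∷ xs) x = last-∷ʳ (_ ∷ xs) x

distinct-⊆⇒length≤ : ∀ {A : Set} {xs ys : List A} → AllPairs _≢_ xs → (∀ {v} → v ∈ xs → v ∈ ys) →
                     length xs ≤ length ys
distinct-⊆⇒length≤ [] _ = z≤n
distinct-⊆⇒length≤ {xs = v ∷ xs} {ys} (v≢xs ∷ distinct) ⊆ys =
  begin
    suc (length xs)          ≤⟨ s≤s (distinct-⊆⇒length≤ distinct ⊆rest) ⟩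
    suc (length (ys ─ v∈ys)) ≡⟨ sym (length-removeAt′ ys (index v∈ys)) ⟩
    length ys                ∎
  where
  open ≤-Reasoning
  v∈ys = ⊆ys (here refl)
  ⊆rest : ∀ {w} → w ∈ xs → w ∈ ys ─ v∈ys
  ⊆rest w∈xs = ∈-─ v∈ys (⊆ys (there w∈xs)) (λ w≡v → All.lookup v≢xs w∈xs (sym w≡v))

-- Algorithm P

module AlgorithmP {n : ℕ} (X : List (BV n)) (r : Rule n) (valid : ValidRule r)
                  (x₀ : BV n) (x₀∈X : x₀ ∈ X) where

  open DecMembership (_≟BV_ {n}) using (_∈?_)

  -- The data of steps (P3)-(P4) exactly as nextP computes them: unvisited h x is the list
  -- whose λ-values are minimised to β = level x (unvisited h x), and N = nearestIn x (onLevel x β).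
  unvisited? : (h : List (BV n)) (x : BV n) → Decidable (λ y → y ≢ x × y ∉ h)
  unvisited? h x y = ¬? (y ≟BV x) ×-dec ¬? (y ∈? h)

  unvisited : List (BV n) → BV n → List (BV n)
  unvisited h x = filter (unvisited? h x) X

  level : BV n → List (BV n) → ℕ
  level x unv = minL (map (lam x) unv)

  onLevel? : (x : BV n) (β : ℕ) → Decidable (λ y → y ≢ x × lam x y ≡ β)
  onLevel? x β y = ¬? (y ≟BV x) ×-dec (lam x y ℕ.≟ β)

  onLevel : BV n → ℕ → List (BV n)
  onLevel x β = filter (onLevel? x β) X

  nearest? : (x : BV n) (C : List (BV n)) → Decidable (λ y → ham x y ≡ minL (map (ham x) C))
  nearest? x C y = ham x y ℕ.≟ minL (map (ham x) C)

  nearestIn : BV n → List (BV n) → List (BV n)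
  nearestIn x C = filter (nearest? x C) C

  record Move (h : List (BV n)) (x y : BV n) : Set where
    field
      y∈X     : y ∈ X
      y≢x     : y ≢ x
      nearest : ∀ {z} → z ∈ X → z ≢ x → lam x z ≡ lam x y → ham x y ≤ ham x z
      lowest  : ∀ {z} → z ∈ X → z ≢ x → z ∉ h → lam x y ≤ lam x z
      reached : ∃ λ u → u ∈ X × u ∉ h × lam x u ≡ lam x y

  data Step (h : List (BV n)) (x : BV n) : Set where
    stop : nextP X r h x ≡ nothing → (∀ {z} → z ∈ X → z ≡ x ⊎ z ∈ h) → Step h x
    move : ∀ {y} → nextP X r h x ≡ just y → Move h x y → Step h x

  nextP-stop : ∀ h x → unvisited h x ≡ [] → nextP X r h x ≡ nothing
  nextP-stop h x unv≡ with unvisited h x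
  nextP-stop h x refl | [] = refl

  nextP-move : ∀ h x {u us} → unvisited h x ≡ u ∷ us →
               nextP X r h x ≡ just (r h (nearestIn x (onLevel x (level x (u ∷ us)))))
  nextP-move h x unv≡ with unvisited h x
  nextP-move h x refl | _ = refl

  chosen : ∀ h x {u us} → unvisited h x ≡ u ∷ us →
           Move h x (r h (nearestIn x (onLevel x (level x (u ∷ us)))))
  chosen h x {u} {us} unv≡
    with minL-map-attained (lam x) (here {xs = us} refl)
  ... | u₀ , u₀∈unv , u₀-level
    with ∈-filter⁻ (unvisited? h x) (subst (u₀ ∈_) (sym unv≡) u₀∈unv)
  ... | u₀∈X , u₀≢x , u₀∉h
    with minL-map-attained (ham x) (∈-filter⁺ (onLevel? x (level x (u ∷ us))) u₀∈X (u₀≢x , u₀-level))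
  ... | w , w∈C , w-nearest = record
    { y∈X     = proj₁ y∈C
    ; y≢x     = proj₁ (proj₂ y∈C)
    ; nearest = λ z∈X z≢x same → subst (_≤ _) (sym (proj₂ y∈N))
                  (minL-map-≤ (ham x) (∈-filter⁺ (onLevel? x β) z∈X (z≢x , trans same y-level)))
    ; lowest  = λ z∈X z≢x z∉h → subst (_≤ _) (sym y-level)
                  (minL-map-≤ (lam x) (subst (_ ∈_) unv≡ (∈-filter⁺ (unvisited? h x) z∈X (z≢x , z∉h))))
    ; reached = u₀ , u₀∈X , u₀∉h , trans u₀-level (sym y-level)
    }
    where
    β = level x (u ∷ us)
    C = onLevel x β
    N = nearestIn x C

    N≢[] : N ≢ []
    N≢[] N≡[] with () ← subst (w ∈_) N≡[] (∈-filter⁺ (nearest? x C) w∈C w-nearest)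

    y∈N : r h N ∈ C × ham x (r h N) ≡ minL (map (ham x) C)
    y∈N = ∈-filter⁻ (nearest? x C) (valid h N N≢[])

    y∈C : r h N ∈ X × r h N ≢ x × lam x (r h N) ≡ β
    y∈C = ∈-filter⁻ (onLevel? x β) (proj₁ y∈N)

    y-level : lam x (r h N) ≡ β
    y-level = proj₂ (proj₂ y∈C)

  step : ∀ h x → Step h x
  step h x with unvisited h x in unv≡
  ... | []     = stop (nextP-stop h x unv≡) covered
    where
    covered : ∀ {z} → z ∈ X → z ≡ x ⊎ z ∈ h
    covered {z} z∈X with z ≟BV x | z ∈? h
    ... | yes z≡x | _       = inj₁ z≡x
    ... | no  _   | yes z∈h = inj₂ z∈h
    ... | no  z≢x | no  z∉h with () ← subst (z ∈_) unv≡ (∈-filter⁺ _ z∈X (z≢x , z∉h))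
  ... | u ∷ us = move (nextP-move h x unv≡) (chosen h x unv≡)

  -- closed makes the visited set a union of λ-classes around x, so all candidates of (P4) are
  -- unvisited.
  record Invariant (h : List (BV n)) (x : BV n) : Set where
    field
      from-x₀  : ∃ λ t → h ≡ x₀ ∷ t
      at-x     : ∃ λ p → h ≡ p ∷ʳ x
      distinct : AllPairs _≢_ h
      ⊆X       : ∀ {v} → v ∈ h → v ∈ X
      path     : Linked (Edge X) h
      closed   : ∀ {v z} → v ∈ h → z ∈ X → lam x z ≡ lam x v → z ∈ h

  open Invariant

  x∈h : ∀ {h x} → Invariant h x → x ∈ h
  x∈h {x = x} inv with at-x inv
  ... | p , refl = ∈-++⁺ʳ p (here refl)

  initial : Invariant (x₀ ∷ []) x₀
  initial = record
    { from-x₀  = [] , refl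
    ; at-x     = [] , refl
    ; distinct = [] ∷ []
    ; ⊆X       = λ { (here refl) → x₀∈X }
    ; path     = [-]
    ; closed   = λ { (here refl) _ same → here (sym (lam≡0⇒≡ (trans same (lam-self x₀)))) }
    }

  advance : ∀ {h x y} → Invariant h x → Move h x y → Invariant (h ∷ʳ y) y
  advance {h} {x} {y} inv mv = record
    { from-x₀  = extend (from-x₀ inv)
    ; at-x     = h , refl
    ; distinct = AllPairs.++⁺ (distinct inv) ([] ∷ []) (All.tabulate (λ v∈h → (λ { refl → y∉h v∈h }) ∷ []))
    ; ⊆X       = ⊆X′
    ; path     = Linked.++⁺ (path inv) (subst (λ m → Connected (Edge X) m (just y)) (sym last-h) (just edge)) [-]
    ; closed   = closed′
    }
    where
    open Move mv

    extend : (∃ λ t → h ≡ x₀ ∷ t) → ∃ λ t → h ∷ʳ y ≡ x₀ ∷ t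
    extend (t , refl) = t ∷ʳ y , refl

    last-h : last h ≡ just x
    last-h with at-x inv
    ... | p , refl = last-∷ʳ p x

    y∉h : y ∉ h
    y∉h y∈h with reached
    ... | u , u∈X , u∉h , u-level = u∉h (closed inv y∈h u∈X u-level)

    edge : Edge X x y
    edge = nearest⇒Edge (λ x≡y → y≢x (sym x≡y)) (⊆X inv (x∈h inv)) y∈X nearest

    ⊆X′ : ∀ {v} → v ∈ h ∷ʳ y → v ∈ X
    ⊆X′ v∈ with ∈-++⁻ h v∈
    ... | inj₁ v∈h         = ⊆X inv v∈h
    ... | inj₂ (here refl) = y∈X

    below-visited : ∀ {z} → z ∈ X → lam x z < lam x y → z ∈ h
    below-visited {z} z∈X lt with z ≟BV x | z ∈? h
    ... | yes refl | _       = x∈h inv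
    ... | no  _    | yes z∈h = z∈h
    ... | no  z≢x  | no  z∉h = ⊥-elim (<⇒≱ lt (lowest z∈X z≢x z∉h))

    closed-h : ∀ {v z} → v ∈ h → z ∈ X → lam y z ≡ lam y v → z ∈ h
    closed-h {v} {z} v∈h z∈X same with <-cmp (lam y v) (lam y x)
    ... | tri< lt _ _ = ⊥-elim (y∉h (closed inv v∈h y∈X
          (trans (lam-sym x y) (trans (sym (lam-isosceles y v x lt)) (lam-sym v x)))))
    ... | tri≈ _ eq _ = below-visited z∈X (subst (lam x z <_) (lam-sym y x)
          (lam-binary y x z (≢⇒lam>0 y≢x) (trans same eq)))
    ... | tri> _ _ gt = closed inv v∈h z∈X
          (trans (lam-isosceles y x z (subst (lam y x <_) (sym same) gt)) (trans same (sym (lam-isosceles y x v gt))))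

    closed′ : ∀ {v z} → v ∈ h ∷ʳ y → z ∈ X → lam y z ≡ lam y v → z ∈ h ∷ʳ y
    closed′ v∈ z∈X same with ∈-++⁻ h v∈
    ... | inj₁ v∈h         = ∈-++⁺ˡ (closed-h v∈h z∈X same)
    ... | inj₂ (here refl) = ∈-++⁺ʳ h (here (sym (lam≡0⇒≡ (trans same (lam-self y)))))

  Progress : ℕ → List (BV n) × BV n → Set
  Progress k (h , x) = Invariant h x × (nextP X r h x ≡ nothing ⊎ k < length h)

  run : ∀ k → Progress k (stateP X x₀ r k)
  run zero = initial , inj₂ (s≤s z≤n)
  run (suc k) with stateP X x₀ r k | run k
  ... | h , x | inv , progress with step h x
  ... | stop done _ rewrite done = inv , inj₁ done
  ... | move {y} moved mv rewrite moved = advance inv mv , inj₂ (grown progress)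
    where
    grown : just y ≡ nothing ⊎ k < length h → suc k < length (h ∷ʳ y)
    grown (inj₁ ())
    grown (inj₂ k<h)  = subst (suc k <_) (sym (trans (length-++ h) (+-comm (length h) 1))) (s≤s k<h)

  hamiltonian : ∀ {h x} → Invariant h x → nextP X r h x ≡ nothing → HamiltonPath X x₀ h
  hamiltonian {h} {x} inv done = from-x₀ inv , distinct inv , covers , (λ _ → ⊆X inv) , path inv
    where
    covers : ∀ z → z ∈ X → z ∈ h
    covers z z∈X with step h x
    ... | move moved _ with () ← trans (sym moved) done
    ... | stop _ covered with covered z∈X
    ...   | inj₁ refl = x∈h inv
    ...   | inj₂ z∈h  = z∈h

  terminates : TerminatesAt X x₀ r (length X) × HamiltonPath X x₀ (visited X x₀ r (length X))
  terminates with stateP X x₀ r (length X) | run (length X)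
  ... | h , x | inv , inj₁ done = done , hamiltonian inv done
  ... | h , x | inv , inj₂ long = ⊥-elim (<⇒≱ long (distinct-⊆⇒length≤ (distinct inv) (⊆X inv)))

theorem1 : (n : ℕ) (X : List (BV n)) → X ≢ [] →
           (r : Rule n) → ValidRule r →
           (x₀ : BV n) → x₀ ∈ X →
           Σ ℕ (λ k → TerminatesAt X x₀ r k × HamiltonPath X x₀ (visited X x₀ r k))
-- X ≢ [] is implied by x₀ ∈ X.
theorem1 n X _ r valid x₀ x₀∈X = length X , AlgorithmP.terminates X r valid x₀ x₀∈X
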